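{- For every integer $m\ge 1$, the Fibonacci cycle chain $\mathcal{C}_F^m$ has a prime vertex labeling.
   Context: All graphs are simple and connected. A graph with $N$ vertices has a prime vertex labeling if its vertices can be labeled bijectively with $1,2,\ldots,N$ so that adjacent vertices receive relatively prime labels. The Fibonacci numbers are $F_1=F_2=1$, $F_i=F_{i-1}+F_{i-2}$. The Fibonacci cycle chain $\mathcal{C}_F^m$ is constructed as follows: start with a path $p_1,p_2,\ldots,p_{m+2}$; add an edge between $p_1$ and $p_3$; then for each $i$ with $3\le i\le m+1$, add a new path with $F_i$ edges (using $F_i-1$ new internal vertices) joining $p_i$ and $p_{i+1}$. The result is a chain of $m$ consecutive cycles, the first having $3$ vertices and, for $j\ge 2$, the $j$th having $F_{j+1}+1$ vertices. -}

module Defs where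

open import Data.Nat using (ℕ; zero; suc; _+_; _∸_; _<_)
open import Data.Fin using (Fin; toℕ; fromℕ<)
open import Data.List using (List; []; _∷_; _++_)
open import Data.Product using (_×_; _,_)
open import Data.Nat.Coprimality using (Coprime)
open import Data.Fin.Permutation using (Permutation′; _⟨$⟩ʳ_)
open import Data.List.Membership.Propositional using (_∈_)

fib : ℕ → ℕ
fib zero = 0
fib (suc zero) = 1
fib (suc (suc n)) = fib n + fib (suc n)

-- A graph on vertex set {0,…,N-1} given by its number of vertices and an edge list.
record Graph : Set where
  field
    size  : ℕ
    edges : List (ℕ × ℕ)
open Graph public

walkEdges : List ℕ → List (ℕ × ℕ)
walkEdges [] = []
walkEdges (x ∷ []) = []
walkEdges (x ∷ y ∷ zs) = (x , y) ∷ walkEdges (y ∷ zs)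

range : ℕ → ℕ → List ℕ
range s zero = []
range s (suc k) = s ∷ range (suc s) k

-- Path vertex p_j is the vertex (j-1), for j = 1,…,m+2.
-- Ears: for i = 3,…,m+1, a path with fib i edges from p_i (= i-1) to p_{i+1} (= i)
-- through fib i - 1 fresh vertices numbered from `next`.
-- ears i c next : the c ears for indices i, i+1, …, i+c-1.
ears : ℕ → ℕ → ℕ → List (ℕ × ℕ)
ears i zero next = []
ears i (suc c) next =
  walkEdges ((i ∸ 1) ∷ (range next (fib i ∸ 1) ++ (i ∷ [])))
  ++ ears (suc i) c (next + (fib i ∸ 1))

earVerts : ℕ → ℕ → ℕ
earVerts i zero = 0
earVerts i (suc c) = (fib i ∸ 1) + earVerts (suc i) c

-- The Fibonacci cycle chain C_F^m, for m ≥ 1.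
-- Path p_1 … p_{m+2} (vertices 0 … m+1), chord p_1 p_3, and ears for i = 3 … m+1
-- (m - 1 ears), fresh vertices numbered from m+2.
fibCycleChain : ℕ → Graph
fibCycleChain m = record
  { size  = (m + 2) + earVerts 3 (m ∸ 1)
  ; edges = walkEdges (range 0 (m + 2)) ++ ((0 , 2) ∷ ears 3 (m ∸ 1) (m + 2))
  }

-- A prime vertex labeling: a bijection of the vertex set {0,…,N-1} onto itself,
-- vertex v receiving label (π v) + 1 ∈ {1,…,N}, with adjacent vertices coprime.
PrimeLabeling : (G : Graph) → Permutation′ (size G) → Set
PrimeLabeling G π =
  ∀ u v (pu : u < size G) (pv : v < size G) → (u , v) ∈ edges G →
    Coprime (suc (toℕ (π ⟨$⟩ʳ fromℕ< pu))) (suc (toℕ (π ⟨$⟩ʳ fromℕ< pv)))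

HasPrimeLabeling : Graph → Set
HasPrimeLabeling G = Data.Product.Σ (Permutation′ (size G)) (PrimeLabeling G)

module Submission where

-- The path vertex p_{v+1} (vertex v,
-- v < m + 2) receives the Fibonacci number F_{v+2}, so the path reads
-- F_2, F_3, …, F_{m+3}; consecutive Fibonacci numbers are coprime, and the
-- chord p_1 p_3 joins the labels 1 and 3.  Ear i (3 ≤ i ≤ m + 1) joins p_i and
-- p_{i+1}, labelled F_{i+1} and F_{i+2} = F_{i+1} + F_i, through F_i - 1 fresh
-- vertices; these get F_{i+1} + 1, …, F_{i+2} - 1 in order, so every ear edge
-- joins consecutive integers.  The fresh labels are exactly the integers that lie
-- strictly between two consecutive Fibonacci numbers, hence all labels are
-- distinct, and the vertex count is F_{m+3}, so the labels are exactly 1, …, F_{m+3}.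

open import Defs
open import Data.Nat using (ℕ; _≥_; zero; suc; _+_; _∸_; _<_; _≤_; z≤n; s≤s; _<?_)
open import Data.Nat.Properties
open import Data.Nat.Coprimality using (Coprime; coprime-+; 1-coprimeTo)
import Data.Nat.Coprimality as Coprime
open import Data.Nat.Solver using (module +-*-Solver)
open import Data.Fin using (Fin; toℕ; fromℕ<; punchOut)
open import Data.Fin.Properties
  using (toℕ-fromℕ<; toℕ-injective; toℕ<n; any?; punchOut-injective; injective⇒≤)
  renaming (_≟_ to _≟ᶠ_)
open import Data.Fin.Permutation using (Permutation′; _⟨$⟩ʳ_; permutation)
open import Data.List using ([]; _∷_; _++_; map)
open import Data.List.Properties using (∷-injective; map-++)
open import Data.List.Membership.Propositional using (_∈_)
open import Data.List.Membership.Propositional.Properties using (∈-++⁻)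
open import Data.List.Relation.Unary.Any using (here; there)
open import Data.Product using (Σ; ∃; _×_; _,_; proj₁; proj₂)
open import Data.Sum using (inj₁; inj₂)
open import Data.Empty using (⊥)
open import Function.Definitions using (Injective)
open import Relation.Nullary using (yes; no; contradiction)
open import Relation.Binary using (tri<; tri≈; tri>)
open import Relation.Binary.PropositionalEquality

-- Pigeonhole: an injective self-map of Fin n is onto.  If y had no preimage,
-- punching y out of the codomain would inject Fin (1 + n) into Fin n.
injective⇒surjective : ∀ {n} (F : Fin n → Fin n) → Injective _≡_ _≡_ F →
                        ∀ y → ∃ λ x → F x ≡ y
injective⇒surjective F F-inj y with any? (λ x → F x ≟ᶠ y)
... | yes found = found
injective⇒surjective {suc n} F F-inj y | no ¬found =
  contradiction (injective⇒≤ {f = punched} punched-inj) 1+n≰n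
  where
  misses : ∀ x → y ≢ F x
  misses x y≡Fx = ¬found (x , sym y≡Fx)
  punched : Fin (suc n) → Fin n
  punched x = punchOut (misses x)
  punched-inj : Injective _≡_ _≡_ punched
  punched-inj e = F-inj (punchOut-injective (misses _) (misses _) e)

injective⇒permutation : ∀ {n} (F : Fin n → Fin n) → Injective _≡_ _≡_ F →
                         Σ (Permutation′ n) λ π → ∀ x → π ⟨$⟩ʳ x ≡ F x
injective⇒permutation F F-inj =
  permutation F (λ y → proj₁ (onto y)) (λ y → proj₂ (onto y))
              (λ x → F-inj (proj₂ (onto (F x))))
  , λ _ → refl
  where
  onto : ∀ y → ∃ λ x → F x ≡ y
  onto = injective⇒surjective F F-inj

record CoprimeLabeling (G : Graph) : Set where
  field
    label     : ℕ → ℕ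
    positive  : ∀ v → v < size G → 1 ≤ label v
    bounded   : ∀ v → v < size G → label v ≤ size G
    injective : ∀ u v → u < size G → v < size G → label u ≡ label v → u ≡ v
    coprime   : ∀ {u v} → (u , v) ∈ edges G → Coprime (label u) (label v)

coprimeLabeling⇒primeLabeling : ∀ G → CoprimeLabeling G → HasPrimeLabeling G
coprimeLabeling⇒primeLabeling G L = proj₁ perm , edge-coprime
  where
  open CoprimeLabeling L
  N : ℕ
  N = size G

  label-1<N : ∀ v → v < N → label v ∸ 1 < N
  label-1<N v v<N = subst (_≤ N) (sym (m+[n∸m]≡n (positive v v<N))) (bounded v v<N)

  position : Fin N → Fin N
  position x = fromℕ< (label-1<N (toℕ x) (toℕ<n x))

  position-label : ∀ x → suc (toℕ (position x)) ≡ label (toℕ x)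
  position-label x = trans (cong suc (toℕ-fromℕ< _)) (m+[n∸m]≡n (positive _ (toℕ<n x)))

  position-injective : Injective _≡_ _≡_ position
  position-injective {x} {y} e = toℕ-injective (injective _ _ (toℕ<n x) (toℕ<n y)
    (trans (sym (position-label x)) (trans (cong (λ z → suc (toℕ z)) e) (position-label y))))

  perm : Σ (Permutation′ N) λ π → ∀ x → π ⟨$⟩ʳ x ≡ position x
  perm = injective⇒permutation position position-injective

  vertex-label : ∀ v (v<N : v < N) → suc (toℕ (proj₁ perm ⟨$⟩ʳ fromℕ< v<N)) ≡ label v
  vertex-label v v<N = trans (position-label (fromℕ< v<N)) (cong label (toℕ-fromℕ< v<N))

  edge-coprime : PrimeLabeling G (proj₁ perm)
  edge-coprime u v u<N v<N uv∈G =
    subst₂ Coprime (sym (vertex-label u u<N)) (sym (vertex-label v v<N)) (coprime uv∈G)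

coprime-step : ∀ {a b} → Coprime a b → Coprime b (a + b)
coprime-step {a} {b} a⊥b = subst (Coprime b) (+-comm b a) (Coprime.sym (coprime-+ a⊥b))

consecutive-coprime : ∀ n → Coprime n (suc n)
consecutive-coprime n = coprime-step (1-coprimeTo n)

fib-coprime : ∀ n → Coprime (fib n) (fib (suc n))
fib-coprime zero    = Coprime.sym (1-coprimeTo 0)
fib-coprime (suc n) = coprime-step (fib-coprime n)

fib-pos : ∀ n → 1 ≤ fib (suc n)
fib-pos zero    = s≤s z≤n
fib-pos (suc n) = ≤-trans (fib-pos n) (m≤n+m (fib (suc n)) (fib n))

fib-step : ∀ n → fib n ≤ fib (suc n)
fib-step zero    = z≤n
fib-step (suc n) = m≤n+m (fib (suc n)) (fib n)

fib-mono : ∀ {a b} → a ≤ b → fib a ≤ fib b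
fib-mono {b = zero}  z≤n = ≤-refl
fib-mono {b = suc b} a≤1+b with m≤n⇒m<n∨m≡n a≤1+b
... | inj₁ (s≤s a≤b) = ≤-trans (fib-mono a≤b) (fib-step b)
... | inj₂ refl      = ≤-refl

-- From F_2 on the Fibonacci numbers increase strictly, as F_{n+3} = F_{n+1} + F_{n+2}.
fib-strict : ∀ {u v} → u < v → fib (2 + u) < fib (2 + v)
fib-strict {u} u<v = <-≤-trans (m<n+m (fib (2 + u)) (fib-pos u)) (fib-mono (s≤s (s≤s u<v)))

fib-injective : ∀ {u v} → fib (2 + u) ≡ fib (2 + v) → u ≡ v
fib-injective {u} {v} e with <-cmp u v
... | tri< u<v _ _ = contradiction e (<⇒≢ (fib-strict u<v))
... | tri≈ _ u≡v _ = u≡v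
... | tri> _ _ v<u = contradiction (sym e) (<⇒≢ (fib-strict v<u))

no-fib-between : ∀ j k → fib j < fib k → fib k < fib (suc j) → ⊥
no-fib-between j k Fj<Fk Fk<Fj+1 with <-cmp j k
... | tri< j<k _ _ = <⇒≱ Fk<Fj+1 (fib-mono j<k)
... | tri≈ _ refl _ = <-irrefl refl Fj<Fk
... | tri> _ _ k<j = <⇒≱ Fj<Fk (fib-mono (<⇒≤ k<j))

range-walk-edge : ∀ s k {u v} → (u , v) ∈ walkEdges (range s k) → v ≡ suc u × suc u < s + k
range-walk-edge s (suc (suc k)) (here refl) =
  refl , subst (2 + s ≤_) (sym (+-suc s (suc k))) (s≤s (subst (suc s ≤_) (sym (+-suc s k)) (s≤s (m≤m+n s k))))
range-walk-edge s (suc (suc k)) {u} (there e) with range-walk-edge (suc s) (suc k) e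
... | v≡1+u , bound = v≡1+u , subst (suc u <_) (sym (+-suc s (suc k))) bound

range-snoc : ∀ s k → range s (suc k) ≡ range s k ++ (s + k ∷ [])
range-snoc s zero    = cong (_∷ []) (sym (+-identityʳ s))
range-snoc s (suc k) = cong (s ∷_) (trans (range-snoc (suc s) k) (cong (λ x → range (suc s) k ++ (x ∷ [])) (sym (+-suc s k))))

map-range : (ℓ : ℕ → ℕ) → ∀ s b k → (∀ t → t < k → ℓ (s + t) ≡ b + t) → map ℓ (range s k) ≡ range b k
map-range ℓ s b zero    shift = refl
map-range ℓ s b (suc k) shift = cong₂ _∷_
  (trans (cong ℓ (sym (+-identityʳ s))) (trans (shift 0 (s≤s z≤n)) (+-identityʳ b)))
  (map-range ℓ (suc s) (suc b) k λ t t<k →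
     trans (cong ℓ (sym (+-suc s t))) (trans (shift (suc t) (s≤s t<k)) (+-suc b t)))

walk-consecutive : (ℓ : ℕ → ℕ) → ∀ xs a k → map ℓ xs ≡ range a k →
                   ∀ {u v} → (u , v) ∈ walkEdges xs → ℓ v ≡ suc (ℓ u)
walk-consecutive ℓ (x ∷ y ∷ zs) a (suc (suc k)) labels (here refl) =
  trans (proj₁ (∷-injective (proj₂ (∷-injective labels)))) (cong suc (sym (proj₁ (∷-injective labels))))
walk-consecutive ℓ (x ∷ y ∷ zs) a (suc (suc k)) labels (there e) =
  walk-consecutive ℓ (y ∷ zs) (suc a) (suc k) (proj₂ (∷-injective labels)) e

caseAt : ℕ → (ℕ → ℕ) → (ℕ → ℕ) → ℕ → ℕ
caseAt a f g t with t <? a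
... | yes _ = f t
... | no  _ = g (t ∸ a)

caseAt-below : ∀ {a f g t} → t < a → caseAt a f g t ≡ f t
caseAt-below {a} {t = t} t<a with t <? a
... | yes _   = refl
... | no  t≮a = contradiction t<a t≮a

caseAt-above : ∀ {a f g} s → caseAt a f g (a + s) ≡ g s
caseAt-above {a} {g = g} s with a + s <? a
... | yes a+s<a = contradiction a+s<a (m+n≮m a s)
... | no  _     = cong g (m+n∸m≡n a s)

data Split (a : ℕ) : ℕ → Set where
  below : ∀ {t} → t < a → Split a t
  above : ∀ s → Split a (a + s)

split : ∀ a t → Split a t
split a t with t <? a
... | yes t<a = below t<a
... | no  t≮a = subst (Split a) (m+[n∸m]≡n (≮⇒≥ t≮a)) (above (t ∸ a))

earLabel : ℕ → ℕ → ℕ → ℕ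
earLabel i zero    = λ _ → 0
earLabel i (suc c) = caseAt (fib i ∸ 1) (λ t → suc (fib (suc i) + t)) (earLabel (suc i) c)

earLabel-first : ∀ i c {t} → t < fib i ∸ 1 → earLabel i (suc c) t ≡ suc (fib (suc i) + t)
earLabel-first i c = caseAt-below {a = fib i ∸ 1}

earLabel-rest : ∀ i c s → earLabel i (suc c) (fib i ∸ 1 + s) ≡ earLabel (suc i) c s
earLabel-rest i c = caseAt-above {a = fib i ∸ 1}

first-ear-below : ∀ i {t} → t < fib i ∸ 1 → suc (fib (suc i) + t) < fib (suc (suc i))
first-ear-below i {t} t<F = shifted (fib i) (fib (suc i)) t<F
  where
  shifted : ∀ a b → t < a ∸ 1 → suc (b + t) < a + b
  shifted (suc a) b t<a = s≤s (subst₂ _≤_ (+-suc b t) (+-comm b a) (+-monoʳ-≤ b t<a))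

earLabel-between : ∀ i c t → t < earVerts i c →
  ∃ λ k → suc i ≤ k × k ≤ i + c × fib k < earLabel i c t × earLabel i c t < fib (suc k)
earLabel-between i (suc c) t t<E with split (fib i ∸ 1) t
... | below t<F =
  suc i , ≤-refl , subst (suc i ≤_) (sym (+-suc i c)) (s≤s (m≤m+n i c))
  , subst (fib (suc i) <_) (sym (earLabel-first i c t<F)) (s≤s (m≤m+n _ t))
  , subst (_< fib (suc (suc i))) (sym (earLabel-first i c t<F)) (first-ear-below i t<F)
... | above s with earLabel-between (suc i) c s (+-cancelˡ-< _ s _ t<E)
...   | k , i<k , k≤ , lower , upper =
  k , <⇒≤ i<k , subst (k ≤_) (sym (+-suc i c)) k≤
  , subst (fib k <_) (sym (earLabel-rest i c s)) lower
  , subst (_< fib (suc k)) (sym (earLabel-rest i c s)) upper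

earLabel-separated : ∀ i c {s t} → s < fib i ∸ 1 → t < earVerts (suc i) c →
                     suc (fib (suc i) + s) < earLabel (suc i) c t
earLabel-separated i c s<F t<E with earLabel-between (suc i) c _ t<E
... | k , i<k , _ , lower , _ = <-≤-trans (first-ear-below i s<F) (≤-trans (fib-mono i<k) (<⇒≤ lower))

-- Distinct fresh vertices get distinct labels: inside one ear the labels are
-- consecutive, and different ears are separated by a Fibonacci number.
earLabel-injective : ∀ i c {s t} → s < earVerts i c → t < earVerts i c →
                     earLabel i c s ≡ earLabel i c t → s ≡ t
earLabel-injective i (suc c) {s} {t} s<E t<E e with split (fib i ∸ 1) s | split (fib i ∸ 1) t
... | below s<F | below t<F =
  +-cancelˡ-≡ (fib (suc i)) s t (suc-injective (trans (sym (earLabel-first i c s<F)) (trans e (earLabel-first i c t<F))))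
... | below s<F | above t′ = contradiction (trans (sym (earLabel-first i c s<F)) (trans e (earLabel-rest i c t′)))
  (<⇒≢ (earLabel-separated i c s<F (+-cancelˡ-< _ t′ _ t<E)))
... | above s′ | below t<F = contradiction (trans (sym (earLabel-first i c t<F)) (trans (sym e) (earLabel-rest i c s′)))
  (<⇒≢ (earLabel-separated i c t<F (+-cancelˡ-< _ s′ _ s<E)))
... | above s′ | above t′ = cong (fib i ∸ 1 +_) (earLabel-injective (suc i) c
  (+-cancelˡ-< _ s′ _ s<E) (+-cancelˡ-< _ t′ _ t<E) (trans (sym (earLabel-rest i c s′)) (trans e (earLabel-rest i c t′))))

-- Counting vertices: c ears starting at index i = 1 + j bring the path end from
-- label F_{i+1} to F_{i+1+c}, each ear l contributing its F_l - 1 fresh labels and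
-- one path label:  c + F_{i+1} + (fresh vertices) = F_{i+1+c}.
ears-total : ∀ j c → c + fib (2 + j) + earVerts (suc j) c ≡ fib (2 + j + c)
ears-total j zero = trans (+-identityʳ (fib (2 + j))) (cong (λ x → fib (2 + x)) (sym (+-identityʳ j)))
ears-total j (suc c) = begin
  suc c + B + (fib (suc j) ∸ 1 + E)       ≡⟨ rearrange c B (fib (suc j) ∸ 1) E ⟩
  c + (suc (fib (suc j) ∸ 1) + B) + E     ≡⟨ cong (λ a → c + (a + B) + E) (m+[n∸m]≡n (fib-pos j)) ⟩
  c + fib (3 + j) + E                     ≡⟨ ears-total (suc j) c ⟩
  fib (3 + j + c)                         ≡⟨ cong (λ x → fib (2 + x)) (sym (+-suc j c)) ⟩
  fib (2 + j + suc c)                     ∎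
  where
  open ≡-Reasoning
  open +-*-Solver
  B E : ℕ
  B = fib (2 + j)
  E = earVerts (2 + j) c
  rearrange : ∀ c b a e → suc c + b + (a + e) ≡ c + (suc a + b) + e
  rearrange = solve 4 (λ c b a e → con 1 :+ c :+ b :+ (a :+ e) := c :+ (con 1 :+ a :+ b) :+ e) refl

-- The labeling of the chain with m = 1 + c, i.e. with c ears.
module ChainLabeling (c : ℕ) where

  G : Graph
  G = fibCycleChain (suc c)

  P : ℕ
  P = suc c + 2

  label : ℕ → ℕ
  label = caseAt P (λ v → fib (2 + v)) (earLabel 3 c)

  label-path : ∀ {v} → v < P → label v ≡ fib (2 + v)
  label-path = caseAt-below {a = P}

  label-fresh : ∀ t → label (P + t) ≡ earLabel 3 c t
  label-fresh = caseAt-above {a = P}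

  chain-size : size G ≡ fib (4 + c)
  chain-size = trans (cong (_+ earVerts 3 c) (sym (+-suc c 2))) (ears-total 2 c)

  path-bound : ∀ {v} → v < P → 2 + v ≤ 4 + c
  path-bound v<P = s≤s (s≤s (≤-trans (≤-pred v<P) (≤-reflexive (+-comm c 2))))

  -- The ear walk from path vertex i-1 = j to path vertex i = 1 + j is labelled by
  -- the consecutive integers F_{i+1}, F_{i+1} + 1, …, F_{i+1} + F_i = F_{i+2}.
  ear-edge-consecutive : ∀ j k next → suc j + k ≤ P →
    (∀ t → label (next + t) ≡ earLabel (suc j) k t) →
    ∀ {u v} → (u , v) ∈ ears (suc j) k next → label v ≡ suc (label u)
  ear-edge-consecutive j (suc k) next bound fresh uv∈ears
    with ∈-++⁻ (walkEdges (j ∷ (range next (fib (suc j) ∸ 1) ++ (suc j ∷ [])))) uv∈ears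
  ... | inj₁ uv∈ear = walk-consecutive label _ B (2 + F) ear-labels uv∈ear
    where
    F B : ℕ
    F = fib (suc j) ∸ 1
    B = fib (2 + j)
    i<P : suc j < P
    i<P = <-≤-trans (m<m+n (suc j) (s≤s z≤n)) bound
    last-label : label (suc j) ≡ suc B + F
    last-label = begin
      label (suc j)            ≡⟨ label-path i<P ⟩
      fib (suc j) + B          ≡⟨ cong (_+ B) (sym (m+[n∸m]≡n (fib-pos j))) ⟩
      suc (F + B)              ≡⟨ cong suc (+-comm F B) ⟩
      suc B + F                ∎
      where open ≡-Reasoning
    ear-labels : map label (j ∷ (range next F ++ (suc j ∷ []))) ≡ range B (2 + F)
    ear-labels = cong₂ _∷_ (label-path (<-trans (n<1+n j) i<P)) (begin
      map label (range next F ++ (suc j ∷ []))        ≡⟨ map-++ label (range next F) _ ⟩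
      map label (range next F) ++ (label (suc j) ∷ []) ≡⟨ cong₂ (λ xs x → xs ++ (x ∷ []))
            (map-range label next (suc B) F λ t t<F → trans (fresh t) (earLabel-first (suc j) k t<F))
            last-label ⟩
      range (suc B) F ++ (suc B + F ∷ [])             ≡⟨ sym (range-snoc (suc B) F) ⟩
      range (suc B) (suc F)                          ∎)
      where open ≡-Reasoning
  ... | inj₂ uv∈later = ear-edge-consecutive (suc j) k (next + F)
      (subst (_≤ P) (cong suc (+-suc j k)) bound) fresh-later uv∈later
    where
    F : ℕ
    F = fib (suc j) ∸ 1
    fresh-later : ∀ t → label (next + F + t) ≡ earLabel (2 + j) k t
    fresh-later t = trans (cong label (+-assoc next F t)) (trans (fresh (F + t)) (earLabel-rest (suc j) k t))

  -- Path edges join consecutive Fibonacci numbers, the chord joins F_2 = 1 and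
  -- F_4 = 3, and ear edges join consecutive integers.
  label-coprime : ∀ {u v} → (u , v) ∈ edges G → Coprime (label u) (label v)
  label-coprime {u} uv∈G with ∈-++⁻ (walkEdges (range 0 P)) uv∈G
  ... | inj₁ uv∈path with range-walk-edge 0 P uv∈path
  ...   | refl , u+1<P = subst₂ Coprime (sym (label-path (<-trans (n<1+n u) u+1<P))) (sym (label-path u+1<P))
                                 (fib-coprime (2 + u))
  label-coprime uv∈G | inj₂ (here refl) =
    subst (λ x → Coprime x (label 2)) (sym (label-path (s≤s z≤n))) (1-coprimeTo (label 2))
  label-coprime {u} uv∈G | inj₂ (there uv∈ears) =
    subst (Coprime (label u)) (sym (ear-edge-consecutive 2 c P ears-fit label-fresh uv∈ears))
          (consecutive-coprime (label u))
    where
    ears-fit : 3 + c ≤ P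
    ears-fit = s≤s (≤-reflexive (+-comm 2 c))

  fresh-not-fib : ∀ {t} → t < earVerts 3 c → ∀ k → earLabel 3 c t ≢ fib k
  fresh-not-fib t<E k e with earLabel-between 3 c _ t<E
  ... | j , _ , _ , lower , upper = no-fib-between j k (subst (fib j <_) e lower) (subst (_< fib (suc j)) e upper)

  -- Path labels are distinct Fibonacci numbers, fresh labels are distinct
  -- non-Fibonacci numbers.
  label-injective : ∀ u v → u < size G → v < size G → label u ≡ label v → u ≡ v
  label-injective u v u<N v<N e with split P u | split P v
  ... | below u<P | below v<P = fib-injective (trans (sym (label-path u<P)) (trans e (label-path v<P)))
  ... | below u<P | above t = contradiction (trans (sym (label-fresh t)) (trans (sym e) (label-path u<P)))
                                            (fresh-not-fib (+-cancelˡ-< P t _ v<N) (2 + u))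
  ... | above s | below v<P = contradiction (trans (sym (label-fresh s)) (trans e (label-path v<P)))
                                            (fresh-not-fib (+-cancelˡ-< P s _ u<N) (2 + v))
  ... | above s | above t = cong (P +_) (earLabel-injective 3 c (+-cancelˡ-< P s _ u<N) (+-cancelˡ-< P t _ v<N)
                                          (trans (sym (label-fresh s)) (trans e (label-fresh t))))

  label-range : ∀ v → v < size G → 1 ≤ label v × label v ≤ fib (4 + c)
  label-range v v<N with split P v
  ... | below v<P = subst (λ x → 1 ≤ x × x ≤ fib (4 + c)) (sym (label-path v<P))
                          (fib-pos (suc v) , fib-mono (path-bound v<P))
  ... | above t with earLabel-between 3 c t (+-cancelˡ-< P t _ v<N)
  ...   | k , _ , k≤3+c , lower , upper = subst (λ x → 1 ≤ x × x ≤ fib (4 + c)) (sym (label-fresh t))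
                          (≤-trans (s≤s z≤n) lower , ≤-trans (<⇒≤ upper) (fib-mono (s≤s k≤3+c)))

  labeling : CoprimeLabeling G
  labeling = record
    { label     = label
    ; positive  = λ v v<N → proj₁ (label-range v v<N)
    ; bounded   = λ v v<N → subst (label v ≤_) (sym chain-size) (proj₂ (label-range v v<N))
    ; injective = label-injective
    ; coprime   = label-coprime
    }

theorem6 : (m : ℕ) → m ≥ 1 → HasPrimeLabeling (fibCycleChain m)
theorem6 zero    ()
theorem6 (suc c) _ = coprimeLabeling⇒primeLabeling (fibCycleChain (suc c)) (ChainLabeling.labeling c)
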